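{- Let $a,b\in\mathbb{R}$, let $F$, $L$ be the generalized Fibonacci and Lucas numbers with parameters $a,b$ (defined in the context), let $(r(n))_{n\ge 0}$ be any sequence of real numbers, and put $p(n)=\sum_{i=0}^n r(i)\,r(n-i)$. Then for all $k,m\in\mathbb{N}$ and all integers $n\ge 0$, $$p(n)\,F(kn+2m)=\sum_{i=0}^n r(i)\,L(ki+m)\,r(n-i)\,F(k(n-i)+m).$$
   Context: For fixed real $a,b$, the generalized Fibonacci numbers are defined for all integers $n$ by $F(n)=0$ for $n\le 0$, $F(1)=1$, and $F(n)=aF(n-1)+bF(n-2)$ for $n>1$. The generalized Lucas numbers are defined for $n\ge 0$ by $\sum_{n\ge 0}L(n)x^n=\frac{2-ax}{1-ax-bx^2}$, i.e. $L(0)=2$ and $L(n)=F(n+1)+bF(n-1)$ for $n\ge 1$. -}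

module Defs where

open import Level using (Level)
open import Data.Nat using (ℕ; zero; suc; _∸_)
open import Algebra.Bundles using (CommutativeRing)

module _ {c ℓ : Level} (R : CommutativeRing c ℓ) where
  open CommutativeRing R using (Carrier; 0#; 1#; _+_; _*_)

  Fib : (a b : Carrier) → ℕ → Carrier
  Fib a b zero = 0#
  Fib a b (suc zero) = 1#
  Fib a b (suc (suc n)) = a * Fib a b (suc n) + b * Fib a b n

  Luc : (a b : Carrier) → ℕ → Carrier
  Luc a b zero = 1# + 1#
  Luc a b (suc n) = Fib a b (suc (suc n)) + b * Fib a b n

  sumTo : ℕ → (ℕ → Carrier) → Carrier
  sumTo zero f = f zero
  sumTo (suc n) f = sumTo n f + f (suc n)

  convSq : (ℕ → Carrier) → ℕ → Carrier
  convSq r n = sumTo n (λ i → r i * r (n ∸ i))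

-- Over any commutative ring, L(x) F(y) + L(y) F(x) = 2 F(x + y) and L(x) F(x) = F(2x),
-- both from the addition formula F(x + y + 1) = F(x + 1) F(y + 1) + b F(x) F(y).
-- In the sum Σᵢ r(i) L(xᵢ) r(n − i) F(x_{n−i}), with xᵢ = k i + m, the terms for i and
-- n − i therefore add up to the corresponding two terms of Σᵢ r(i) r(n − i) F(kn + 2m),
-- and the middle term (n even) agrees on its own. Pairing off the two ends of the sum
-- avoids dividing by 2, so the identity holds in characteristic 2 as well.
module Submission where

open import Defs
open import Level using (Level)
open import Data.Nat using (ℕ; _∸_; zero; suc; _≤_; z≤n) renaming (_+_ to _+ℕ_; _*_ to _*ℕ_)
import Data.Nat.Properties as ℕ
open import Algebra.Bundles using (CommutativeRing)
open import Relation.Binary.PropositionalEquality as ≡ using (_≡_)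
import Data.Nat.Solver as ℕ-Solver
import Algebra.Properties.CommutativeSemigroup as CommSemigroupProperties
import Algebra.Solver.Ring.NaturalCoefficients.Default as RingSolver
import Relation.Binary.Reasoning.Setoid as SetoidReasoning

antidiagonal-index-sum : ∀ k m {i n} → i ≤ n →
                         (k *ℕ i +ℕ m) +ℕ (k *ℕ (n ∸ i) +ℕ m) ≡ k *ℕ n +ℕ 2 *ℕ m
antidiagonal-index-sum k m {i} {n} i≤n = ≡.trans
  (regroup k i (n ∸ i) m)
  (≡.cong (λ j → k *ℕ j +ℕ 2 *ℕ m) (ℕ.m+[n∸m]≡n i≤n))
  where
  open ℕ-Solver.+-*-Solver
  regroup : ∀ k i j m → (k *ℕ i +ℕ m) +ℕ (k *ℕ j +ℕ m) ≡ k *ℕ (i +ℕ j) +ℕ 2 *ℕ m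
  regroup = solve 4 (λ k i j m → (k :* i :+ m) :+ (k :* j :+ m) := k :* (i :+ j) :+ con 2 :* m) ≡.refl

module _ {c ℓ : Level} (R : CommutativeRing c ℓ) where
  open CommutativeRing R
  open SetoidReasoning setoid
  open CommSemigroupProperties +-commutativeSemigroup using (xy∙z≈xz∙y)
  open RingSolver commutativeSemiring using (solve; con; _:+_; _:*_; _:=_)

  sumTo-cong : ∀ d {f g : ℕ → Carrier} → (∀ t → t ≤ d → f t ≈ g t) → sumTo R d f ≈ sumTo R d g
  sumTo-cong zero    f≈g = f≈g 0 z≤n
  sumTo-cong (suc d) f≈g =
    +-cong (sumTo-cong d (λ t t≤d → f≈g t (ℕ.m≤n⇒m≤1+n t≤d))) (f≈g (suc d) ℕ.≤-refl)

  sumTo-*ʳ : ∀ d (f : ℕ → Carrier) x → sumTo R d f * x ≈ sumTo R d (λ t → f t * x)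
  sumTo-*ʳ zero    f x = refl
  sumTo-*ʳ (suc d) f x = trans (distribʳ x _ _) (+-congʳ (sumTo-*ʳ d f x))

  sumTo-suc-head : ∀ d (f : ℕ → Carrier) → sumTo R (suc d) f ≈ f 0 + sumTo R d (λ t → f (suc t))
  sumTo-suc-head zero    f = refl
  sumTo-suc-head (suc d) f = trans (+-congʳ (sumTo-suc-head d f)) (+-assoc _ _ _)

  sumTo-head-last : ∀ d (f : ℕ → Carrier) →
                    sumTo R (suc (suc d)) f ≈ (f 0 + f (suc (suc d))) + sumTo R d (λ t → f (suc t))
  sumTo-head-last d f = trans (+-congʳ (sumTo-suc-head d f)) (xy∙z≈xz∙y _ _ _)

  antidiagonal-sum-cong : ∀ {φ ψ : ℕ → ℕ → Carrier} →
    (∀ i j → φ i j + φ j i ≈ ψ i j + ψ j i) → (∀ i → φ i i ≈ ψ i i) →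
    ∀ d → sumTo R d (λ t → φ t (d ∸ t)) ≈ sumTo R d (λ t → ψ t (d ∸ t))
  antidiagonal-sum-cong sym≈ diag≈ zero          = diag≈ 0
  antidiagonal-sum-cong sym≈ diag≈ (suc zero)    = sym≈ 0 1
  antidiagonal-sum-cong {φ} {ψ} sym≈ diag≈ (suc (suc d)) = begin
    sumTo R (suc (suc d)) (antidiagonal φ)
      ≈⟨ sumTo-head-last d (antidiagonal φ) ⟩
    (φ 0 (2 +ℕ d) + φ (2 +ℕ d) (d ∸ d)) + sumTo R d (λ t → antidiagonal φ (suc t))
      ≈⟨ +-cong ends inner ⟩
    (ψ 0 (2 +ℕ d) + ψ (2 +ℕ d) (d ∸ d)) + sumTo R d (λ t → antidiagonal ψ (suc t))
      ≈⟨ sumTo-head-last d (antidiagonal ψ) ⟨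
    sumTo R (suc (suc d)) (antidiagonal ψ) ∎
    where
    antidiagonal : (ℕ → ℕ → Carrier) → ℕ → Carrier
    antidiagonal χ t = χ t (suc (suc d) ∸ t)

    ends : φ 0 (2 +ℕ d) + φ (2 +ℕ d) (d ∸ d) ≈ ψ 0 (2 +ℕ d) + ψ (2 +ℕ d) (d ∸ d)
    ends rewrite ℕ.n∸n≡0 d = sym≈ 0 (2 +ℕ d)

    shifted : ∀ χ t → t ≤ d → antidiagonal χ (suc t) ≈ χ (suc t) (suc (d ∸ t))
    shifted χ t t≤d = reflexive (≡.cong (χ (suc t)) (ℕ.+-∸-assoc 1 t≤d))

    inner : sumTo R d (λ t → antidiagonal φ (suc t)) ≈ sumTo R d (λ t → antidiagonal ψ (suc t))
    inner = begin
      sumTo R d (λ t → antidiagonal φ (suc t))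
        ≈⟨ sumTo-cong d (shifted φ) ⟩
      sumTo R d (λ t → φ (suc t) (suc (d ∸ t)))
        ≈⟨ antidiagonal-sum-cong (λ i j → sym≈ (suc i) (suc j)) (λ i → diag≈ (suc i)) d ⟩
      sumTo R d (λ t → ψ (suc t) (suc (d ∸ t)))
        ≈⟨ sumTo-cong d (shifted ψ) ⟨
      sumTo R d (λ t → antidiagonal ψ (suc t)) ∎

  module _ (a b : Carrier) where
    private
      F L : ℕ → Carrier
      F = Fib R a b
      L = Luc R a b

    Fib-suc-+ : ∀ x y → F (suc (x +ℕ y)) ≈ F (suc x) * F (suc y) + b * F x * F y
    Fib-suc-+ zero y = solve 3 (λ b f g → f := (con 1 :* f :+ b :* con 0 :* g)) refl b (F (suc y)) (F y)
    Fib-suc-+ (suc zero) y =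
      solve 4 (λ a b f g → (a :* f :+ b :* g) := ((a :* con 1 :+ b :* con 0) :* f :+ b :* con 1 :* g))
            refl a b (F (suc y)) (F y)
    Fib-suc-+ (suc (suc x)) y = begin
      a * F (suc (suc (x +ℕ y))) + b * F (suc (x +ℕ y))
        ≈⟨ +-cong (*-congˡ (Fib-suc-+ (suc x) y)) (*-congˡ (Fib-suc-+ x y)) ⟩
      a * (F (suc (suc x)) * F (suc y) + b * F (suc x) * F y) + b * (F (suc x) * F (suc y) + b * F x * F y)
        ≈⟨ solve 6 (λ a b p q s t → (a :* ((a :* p :+ b :* q) :* s :+ b :* p :* t) :+ b :* (p :* s :+ b :* q :* t))
                     := ((a :* (a :* p :+ b :* q) :+ b :* p) :* s :+ b :* (a :* p :+ b :* q) :* t))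
                 refl a b (F (suc x)) (F x) (F (suc y)) (F y) ⟩
      F (suc (suc (suc x))) * F (suc y) + b * F (suc (suc x)) * F y ∎

    Luc*Fib-diagonal : ∀ x → L x * F x ≈ F (x +ℕ x)
    Luc*Fib-diagonal zero    = zeroʳ _
    Luc*Fib-diagonal (suc x) = begin
      (F (suc (suc x)) + b * F x) * F (suc x)
        ≈⟨ solve 4 (λ b P p q → ((P :+ b :* q) :* p) := (p :* P :+ b :* q :* p)) refl b _ _ _ ⟩
      F (suc x) * F (suc (suc x)) + b * F x * F (suc x)
        ≈⟨ Fib-suc-+ x (suc x) ⟨
      F (suc (x +ℕ suc x)) ∎

    Luc*Fib-symmetrised : ∀ x y → L x * F y + L y * F x ≈ F (x +ℕ y) + F (x +ℕ y)
    Luc*Fib-symmetrised zero y = begin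
      (1# + 1#) * F y + L y * 0#   ≈⟨ +-congˡ (zeroʳ _) ⟩
      (1# + 1#) * F y + 0#         ≈⟨ +-identityʳ _ ⟩
      (1# + 1#) * F y              ≈⟨ distribʳ _ _ _ ⟩
      1# * F y + 1# * F y          ≈⟨ +-cong (*-identityˡ _) (*-identityˡ _) ⟩
      F y + F y ∎
    Luc*Fib-symmetrised (suc x) zero rewrite ℕ.+-identityʳ x =
      trans (+-comm _ _) (Luc*Fib-symmetrised 0 (suc x))
    Luc*Fib-symmetrised (suc x) (suc y) = begin
      (F (suc (suc x)) + b * F x) * F (suc y) + (F (suc (suc y)) + b * F y) * F (suc x)
        ≈⟨ solve 7 (λ b P p q S s t → ((P :+ b :* q) :* s :+ (S :+ b :* t) :* p)
                     := ((p :* S :+ b :* q :* s) :+ (s :* P :+ b :* t :* p))) refl b _ _ _ _ _ _ ⟩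
      (F (suc x) * F (suc (suc y)) + b * F x * F (suc y)) + (F (suc y) * F (suc (suc x)) + b * F y * F (suc x))
        ≈⟨ +-cong (Fib-suc-+ x (suc y)) (Fib-suc-+ y (suc x)) ⟨
      F (suc (x +ℕ suc y)) + F (suc (y +ℕ suc x))
        ≈⟨ +-congˡ (reflexive (≡.cong F (+-suc-comm y x))) ⟩
      F (suc (x +ℕ suc y)) + F (suc (x +ℕ suc y)) ∎
      where
      +-suc-comm : ∀ x y → suc (x +ℕ suc y) ≡ suc (y +ℕ suc x)
      +-suc-comm x y = ≡.cong suc (≡.trans (ℕ.+-suc x y) (≡.trans (≡.cong suc (ℕ.+-comm x y)) (≡.sym (ℕ.+-suc y x))))

    weighted-Luc*Fib-symmetrised : ∀ (u v : Carrier) x y →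
      u * L x * v * F y + v * L y * u * F x ≈ u * v * F (x +ℕ y) + v * u * F (y +ℕ x)
    weighted-Luc*Fib-symmetrised u v x y = begin
      u * L x * v * F y + v * L y * u * F x
        ≈⟨ solve 6 (λ u v l f l′ f′ → (u :* l :* v :* f :+ v :* l′ :* u :* f′) := (u :* v :* (l :* f :+ l′ :* f′)))
                 refl u v (L x) (F y) (L y) (F x) ⟩
      u * v * (L x * F y + L y * F x)
        ≈⟨ *-congˡ (Luc*Fib-symmetrised x y) ⟩
      u * v * (F (x +ℕ y) + F (x +ℕ y))
        ≈⟨ solve 3 (λ u v s → (u :* v :* (s :+ s)) := (u :* v :* s :+ v :* u :* s)) refl u v _ ⟩
      u * v * F (x +ℕ y) + v * u * F (x +ℕ y)
        ≈⟨ +-congˡ (*-congˡ (reflexive (≡.cong F (ℕ.+-comm x y)))) ⟩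
      u * v * F (x +ℕ y) + v * u * F (y +ℕ x) ∎

    weighted-Luc*Fib-diagonal : ∀ (u : Carrier) x → u * L x * u * F x ≈ u * u * F (x +ℕ x)
    weighted-Luc*Fib-diagonal u x = begin
      u * L x * u * F x   ≈⟨ solve 3 (λ u l f → (u :* l :* u :* f) := (u :* u :* (l :* f))) refl u (L x) (F x) ⟩
      u * u * (L x * F x) ≈⟨ *-congˡ (Luc*Fib-diagonal x) ⟩
      u * u * F (x +ℕ x)  ∎

theorem5 : {c ℓ : Level} (R : CommutativeRing c ℓ) →
    let open CommutativeRing R in
    (a b : Carrier) (r : ℕ → Carrier) (k m n : ℕ) →
    convSq R r n * Fib R a b (k *ℕ n +ℕ 2 *ℕ m)
    ≈ sumTo R n (λ i → r i * Luc R a b (k *ℕ i +ℕ m) * r (n ∸ i) * Fib R a b (k *ℕ (n ∸ i) +ℕ m))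
theorem5 R a b r k m n = begin
  convSq R r n * F (k *ℕ n +ℕ 2 *ℕ m)
    ≈⟨ sumTo-*ʳ R n _ _ ⟩
  sumTo R n (λ i → r i * r (n ∸ i) * F (k *ℕ n +ℕ 2 *ℕ m))
    ≈⟨ sumTo-cong R n (λ i i≤n → *-congˡ (reflexive (≡.cong F (≡.sym (antidiagonal-index-sum k m i≤n))))) ⟩
  sumTo R n (λ i → r i * r (n ∸ i) * F (x i +ℕ x (n ∸ i)))
    ≈⟨ antidiagonal-sum-cong R
         (λ i j → weighted-Luc*Fib-symmetrised R a b (r i) (r j) (x i) (x j))
         (λ i → weighted-Luc*Fib-diagonal R a b (r i) (x i)) n ⟨
  sumTo R n (λ i → r i * L (x i) * r (n ∸ i) * F (x (n ∸ i))) ∎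
  where
  open CommutativeRing R
  open SetoidReasoning setoid
  F L : ℕ → Carrier
  F = Fib R a b
  L = Luc R a b
  x : ℕ → ℕ
  x i = k *ℕ i +ℕ m
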